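{- Let $C$ be the curve $t^4-1=-6s^2$ over $\mathbb{Q}$, $E'$ the elliptic curve $y^2=x^3+9x$, and $h:E'\to C$ the map $h(x,y)=\left(\frac{3-x}{3+x},\frac{ -2y}{(x+3)^2}\right)$. Let $T=[4,10]\in E'(\mathbb{Q})$ and for an integer $k$ let $(t_k,s_k)=h([k]T)$. Let $k$ be a positive integer. If $k\equiv 0\pmod 3$ then $v_3(s_k)>0$ and $v_3(t_k-2)\ge 1$. If $k\equiv 1,2\pmod 3$ then $v_3(t_k-5)\ge 2$ and $v_3(s_k)=0$.
   Context: For a prime $p$ and $q\in\mathbb{Q}$, $v_p(q)$ denotes the $p$-adic valuation of $q$, normalized so that $v_p(p)=1$. $[k]T$ denotes multiplication by $k$ in the group $E'(\mathbb{Q})$. -}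

module Defs where

open import Data.Nat as ℕ using (ℕ; zero; suc)
open import Data.Nat.Divisibility using (_∣?_)
open import Data.Integer as ℤ using (ℤ; +_)
open import Data.Rational as ℚ using (ℚ; 0ℚ; 1ℚ; _+_; _*_; _-_; -_; _÷_; ≢-nonZero; ↥_; ↧ₙ_)
open import Data.Rational.Properties using (_≟_)
open import Data.Maybe using (Maybe; just; nothing)
open import Data.Product using (_×_; _,_)
open import Data.Unit using (⊤)
open import Relation.Nullary using (yes; no)

-- exponent of p in n (n > 0); the fuel argument (taken = n) bounds recursion.
vℕ-go : (p : ℕ) → .{{_ : ℕ.NonZero p}} → ℕ → ℕ → ℕ
vℕ-go p zero    n = 0
vℕ-go p (suc f) zero = 0
vℕ-go p (suc f) (suc m) with p ∣? suc m
... | yes _ = suc (vℕ-go p f (suc m ℕ./ p))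
... | no _  = 0

vℕ : (p : ℕ) → .{{_ : ℕ.NonZero p}} → ℕ → ℕ
vℕ p n = vℕ-go p n n

-- v_p(q) = v_p(numerator) - v_p(denominator); nothing encodes v_p(0) = +∞.
v : (p : ℕ) → .{{_ : ℕ.NonZero p}} → ℚ → Maybe ℤ
v p q with q ≟ 0ℚ
... | yes _ = nothing
... | no _  = just (+ vℕ p ℤ.∣ ↥ q ∣ ℤ.- + vℕ p (↧ₙ q))

infix 4 _≥ᵥ_
_≥ᵥ_ : Maybe ℤ → ℤ → Set
nothing ≥ᵥ n = ⊤
just a  ≥ᵥ n = n ℤ.≤ a

-- division, only ever applied to nonzero denominators below
_//_ : ℚ → ℚ → ℚ
a // b with b ≟ 0ℚ
... | yes _ = 0ℚ
... | no b≢0 = _÷_ a b {{≢-nonZero b≢0}}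

q : ℤ → ℚ
q z = z ℚ./ 1

data Point : Set where
  O   : Point
  aff : ℚ → ℚ → Point

aE : ℚ
aE = q (+ 9)

_⊕_ : Point → Point → Point
O ⊕ P = P
aff x y ⊕ O = aff x y
aff x₁ y₁ ⊕ aff x₂ y₂ with x₁ ≟ x₂
... | no _ = aff x₃ (λs * (x₁ - x₃) - y₁)
  where
  λs = (y₂ - y₁) // (x₂ - x₁)
  x₃ = λs * λs - x₁ - x₂
... | yes _ with y₁ ≟ - y₂
...   | yes _ = O
...   | no _  = aff x₃ (λs * (x₁ - x₃) - y₁)
  where
  λs = (q (+ 3) * x₁ * x₁ + aE) // (q (+ 2) * y₁)
  x₃ = λs * λs - x₁ - x₁

[_]_ : ℕ → Point → Point
[ zero ]  P = O
[ suc k ] P = P ⊕ ([ k ] P)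

T : Point
T = aff (q (+ 4)) (q (+ 10))

-- h : E' → C,  C : t⁴ - 1 = -6 s²,
-- h(x,y) = ((3 - x)/(3 + x), -2y/(x + 3)²); O ↦ (-1, 0) (the limit value;
-- never used for k ≥ 1 since T has infinite order).
h : Point → ℚ × ℚ
h O = (- 1ℚ , 0ℚ)
h (aff x y) = ((q (+ 3) - x) // (q (+ 3) + x) , (q (ℤ.- (+ 2)) * y) // ((x + q (+ 3)) * (x + q (+ 3))))

tₖ : ℕ → ℚ
tₖ k = Data.Product.proj₁ (h ([ k ] T))

sₖ : ℕ → ℚ
sₖ k = Data.Product.proj₂ (h ([ k ] T))

-- Modulo 3, E' reduces to the cuspidal cubic y² = x³, whose smooth points form a group
-- isomorphic to 𝔽₃ via (x , y) ↦ x / y, the point at infinity going to 0. As T reduces to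
-- (1 , 1), the reduction of [k]T is the point at infinity, (1 , 1) or (1 , -1) according as
-- k ≡ 0, 1 or 2 (mod 3); this is checked directly by showing that adding T moves each of these
-- three classes to the next, computing with 3-integral rationals modulo 3. Near (1 , ±1) the
-- formula for h gives t ≡ 5 (mod 9) and s ≡ ±1 (mod 3); near infinity, in the local coordinates
-- u = 1/x and w = x/y, it gives t ≡ 2 and s ≡ 0 (mod 3).

module Submission where

open import Defs
open import Data.Nat using (ℕ; _≤_; _%_)
open import Data.Integer using (+_)
open import Data.Rational using (_-_; _/_)
open import Data.Maybe using (just)
open import Data.Product using (_×_)
open import Relation.Binary.PropositionalEquality using (_≡_; _≢_)

import Data.Integer.GCD as ℤG
import Data.Integer.Properties as ℤP
import Data.Integer.Tactic.RingSolver as ℤSolver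
import Data.Nat.Coprimality as Coprimality
import Data.Nat.DivMod as ℕDivMod
import Data.Nat.Divisibility as ℕDiv
import Data.Nat.Properties as ℕP
import Data.Maybe as Maybe
import Data.Rational.Properties as ℚP
import Data.Rational.Unnormalised as ℚᵘ
import Data.Rational.Unnormalised.Properties as ℚᵘP
import Tactic.RingSolver as ℚSolver
import Tactic.RingSolver.Core.AlmostCommutativeRing as ACR
open import Data.Empty using (⊥; ⊥-elim)
open import Data.Integer as ℤ using (ℤ; -[1+_])
open import Data.Integer.Divisibility.Signed
  using (_∣_; divides; _∣?_; ∣-trans; ∣m∣n⇒∣m+n; ∣m∣n⇒∣m-n; ∣m⇒∣-m; ∣m⇒∣m*n; ∣n⇒∣m*n; ∣⇒∣ᵤ; ∣ᵤ⇒∣; *-cancelˡ-∣; *-monoʳ-∣)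
open import Data.List using (_∷_; [])
open import Data.Nat as ℕ using (zero; suc; z≤n; s≤s)
open import Data.Nat.Primality using (Prime; prime?; euclidsLemma)
open import Data.Product using (_,_; proj₁; proj₂)
open import Data.Rational as ℚ using (ℚ; 0ℚ; 1ℚ; _+_; _*_; -_; ↥_; ↧_; ↧ₙ_; 1/_; mkℚ)
open import Data.Sum using (inj₁; inj₂)
open import Data.Unit using (tt)
open import Level using (0ℓ)
open import Relation.Binary.PropositionalEquality using (refl; sym; trans; cong; cong₂; subst; module ≡-Reasoning)
open import Relation.Nullary using (¬_; yes; no)
open import Relation.Nullary.Decidable using (from-yes; from-no; dec⇒maybe)

∣-resp : ∀ {m a b} → m ∣ a → a ≡ b → m ∣ b
∣-resp m∣a refl = m∣a

infix 4 3∤_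

3∤_ : ℤ → Set
3∤ z = ¬ (+ 3 ∣ z)

3-prime : Prime 3
3-prime = from-yes (prime? 3)

3∤-* : ∀ {a b} → 3∤ a → 3∤ b → 3∤ (a ℤ.* b)
3∤-* {a} {b} 3∤a 3∤b 3∣ab
  with euclidsLemma ℤ.∣ a ∣ ℤ.∣ b ∣ 3-prime (subst (3 ℕDiv.∣_) (ℤP.abs-* a b) (∣⇒∣ᵤ 3∣ab))
... | inj₁ 3∣a = 3∤a (∣ᵤ⇒∣ 3∣a)
... | inj₂ 3∣b = 3∤b (∣ᵤ⇒∣ 3∣b)

3∤-resp : ∀ {a b} → + 3 ∣ b ℤ.- a → 3∤ a → 3∤ b
3∤-resp {a} {b} 3∣b-a 3∤a 3∣b =
  3∤a (subst (+ 3 ∣_) (b-[b-a]≡a a b) (∣m∣n⇒∣m-n 3∣b 3∣b-a))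
  where
  b-[b-a]≡a : ∀ a b → b ℤ.- (b ℤ.- a) ≡ a
  b-[b-a]≡a = ℤSolver.solve-∀

3∣-cancelʳ : ∀ {a b} → + 3 ∣ a ℤ.* b → 3∤ b → + 3 ∣ a
3∣-cancelʳ {a} 3∣ab 3∤b with + 3 ∣? a
... | yes 3∣a = 3∣a
... | no 3∤a = ⊥-elim (3∤-* 3∤a 3∤b 3∣ab)

9∣⇒3∣ : ∀ {a} → + 9 ∣ a → + 3 ∣ a
9∣⇒3∣ = ∣-trans (divides (+ 3) refl)

9∣-cancelʳ : ∀ {a b} → + 9 ∣ a ℤ.* b → 3∤ b → + 9 ∣ a
9∣-cancelʳ {a} {b} 9∣ab 3∤b = 3∣a⇒9∣a (3∣-cancelʳ (9∣⇒3∣ 9∣ab) 3∤b)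
  where
  3∣a⇒9∣a : + 3 ∣ a → + 9 ∣ a
  3∣a⇒9∣a (divides k a≡k*3) = 3∣k⇒9∣a (3∣-cancelʳ 3∣k*b 3∤b)
    where
    3∣k*b : + 3 ∣ k ℤ.* b
    3∣k*b = *-cancelˡ-∣ (+ 3) {+ 3} {k ℤ.* b} (∣-resp 9∣ab (trans (cong (ℤ._* b) a≡k*3)
              (trans (cong (ℤ._* b) (ℤP.*-comm k (+ 3))) (ℤP.*-assoc (+ 3) k b))))
    3∣k⇒9∣a : + 3 ∣ k → + 9 ∣ a
    3∣k⇒9∣a (divides j k≡j*3) =
      divides j (trans a≡k*3 (trans (cong (ℤ._* + 3) k≡j*3) (ℤP.*-assoc j (+ 3) (+ 3))))

ℚ-ring : ACR.AlmostCommutativeRing 0ℓ 0ℓ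
ℚ-ring = ACR.fromCommutativeRing ℚP.+-*-commutativeRing
  λ x → Maybe.map sym (dec⇒maybe (x ℚP.≟ 0ℚ))

↥-q : ∀ z → ↥ (q z) ≡ z
↥-q z = trans (sym (ℤP.*-identityʳ (↥ (q z))))
          (trans (cong (↥ (q z) ℤ.*_) (sym (ℤG.gcd-zeroʳ z))) (ℚP.↥-/ z 1))

↧-q : ∀ z → ↧ (q z) ≡ + 1
↧-q z = trans (sym (ℤP.*-identityʳ (↧ (q z))))
          (trans (cong (↧ (q z) ℤ.*_) (sym (ℤG.gcd-zeroʳ z))) (ℚP.↧-/ z 1))

q-injective : ∀ {a b} → q a ≡ q b → a ≡ b
q-injective {a} {b} qa≡qb = trans (sym (↥-q a)) (trans (cong ↥_ qa≡qb) (↥-q b))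

toℚᵘ-q : ∀ z → ℚ.toℚᵘ (q z) ℚᵘ.≃ ℚᵘ.mkℚᵘ z 0
toℚᵘ-q z = ℚᵘ.*≡* (cong₂ ℤ._*_ (trans (ℚP.↥ᵘ-toℚᵘ (q z)) (↥-q z))
                               (sym (trans (ℚP.↧ᵘ-toℚᵘ (q z)) (↧-q z))))

q-+ : ∀ a b → q (a ℤ.+ b) ≡ q a + q b
q-+ a b = ℚP.toℚᵘ-injective (begin
  ℚ.toℚᵘ (q (a ℤ.+ b))                ≈⟨ toℚᵘ-q (a ℤ.+ b) ⟩
  ℚᵘ.mkℚᵘ (a ℤ.+ b) 0                 ≈⟨ ℚᵘ.*≡* (cross-identity a b) ⟩
  ℚᵘ.mkℚᵘ a 0 ℚᵘ.+ ℚᵘ.mkℚᵘ b 0        ≈⟨ ℚᵘP.+-cong (ℚᵘP.≃-sym (toℚᵘ-q a)) (ℚᵘP.≃-sym (toℚᵘ-q b)) ⟩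
  ℚ.toℚᵘ (q a) ℚᵘ.+ ℚ.toℚᵘ (q b)      ≈⟨ ℚᵘP.≃-sym (ℚP.toℚᵘ-homo-+ (q a) (q b)) ⟩
  ℚ.toℚᵘ (q a + q b)                  ∎)
  where
  open ℚᵘP.≃-Reasoning
  cross-identity : ∀ a b → (a ℤ.+ b) ℤ.* + 1 ≡ (a ℤ.* + 1 ℤ.+ b ℤ.* + 1) ℤ.* + 1
  cross-identity = ℤSolver.solve-∀

q-* : ∀ a b → q (a ℤ.* b) ≡ q a * q b
q-* a b = ℚP.toℚᵘ-injective (begin
  ℚ.toℚᵘ (q (a ℤ.* b))                ≈⟨ toℚᵘ-q (a ℤ.* b) ⟩
  ℚᵘ.mkℚᵘ a 0 ℚᵘ.* ℚᵘ.mkℚᵘ b 0        ≈⟨ ℚᵘP.*-cong (ℚᵘP.≃-sym (toℚᵘ-q a)) (ℚᵘP.≃-sym (toℚᵘ-q b)) ⟩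
  ℚ.toℚᵘ (q a) ℚᵘ.* ℚ.toℚᵘ (q b)      ≈⟨ ℚᵘP.≃-sym (ℚP.toℚᵘ-homo-* (q a) (q b)) ⟩
  ℚ.toℚᵘ (q a * q b)                  ∎)
  where open ℚᵘP.≃-Reasoning

q-neg : ∀ a → q (ℤ.- a) ≡ - q a
q-neg a = ℚP.toℚᵘ-injective (begin
  ℚ.toℚᵘ (q (ℤ.- a))                  ≈⟨ toℚᵘ-q (ℤ.- a) ⟩
  ℚᵘ.- ℚᵘ.mkℚᵘ a 0                    ≈⟨ ℚᵘP.-‿cong (ℚᵘP.≃-sym (toℚᵘ-q a)) ⟩
  ℚᵘ.- ℚ.toℚᵘ (q a)                   ≈⟨ ℚᵘP.≃-sym (ℚP.toℚᵘ-homo‿- (q a)) ⟩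
  ℚ.toℚᵘ (- q a)                      ∎)
  where open ℚᵘP.≃-Reasoning

q-↧*≡↥ : ∀ x → x * q (↧ x) ≡ q (↥ x)
q-↧*≡↥ x@(mkℚ n d _) = ℚP.toℚᵘ-injective (begin
  ℚ.toℚᵘ (x * q (↧ x))                ≈⟨ ℚP.toℚᵘ-homo-* x (q (↧ x)) ⟩
  ℚᵘ.mkℚᵘ n d ℚᵘ.* ℚ.toℚᵘ (q (↧ x))   ≈⟨ ℚᵘP.*-congˡ {ℚᵘ.mkℚᵘ n d} (toℚᵘ-q (↧ x)) ⟩
  ℚᵘ.mkℚᵘ n d ℚᵘ.* ℚᵘ.mkℚᵘ (↧ x) 0    ≈⟨ ℚᵘ.*≡* (trans (ℤP.*-identityʳ _) (cong (λ e → n ℤ.* + e) (sym (ℕP.*-identityʳ (suc d))))) ⟩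
  ℚᵘ.mkℚᵘ n 0                         ≈⟨ ℚᵘP.≃-sym (toℚᵘ-q n) ⟩
  ℚ.toℚᵘ (q (↥ x))                    ∎)
  where open ℚᵘP.≃-Reasoning

//-*-cancel : ∀ a {b} → b ≢ 0ℚ → (a // b) * b ≡ a
//-*-cancel a {b} b≢0 with b ℚP.≟ 0ℚ
... | yes b≡0 = ⊥-elim (b≢0 b≡0)
... | no b≢0 = begin
  a * 1/ b * b    ≡⟨ ℚP.*-assoc a (1/ b) b ⟩
  a * (1/ b * b)  ≡⟨ cong (a *_) (ℚP.*-inverseˡ b) ⟩
  a * 1ℚ          ≡⟨ ℚP.*-identityʳ a ⟩
  a               ∎
  where
  open ≡-Reasoning
  instance _ = ℚ.≢-nonZero b≢0

*-cancelʳ-≡ : ∀ {a b} c → c ≢ 0ℚ → a * c ≡ b * c → a ≡ b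
*-cancelʳ-≡ {a} {b} c c≢0 ac≡bc = begin
  a                ≡⟨ cancel a ⟩
  a * c * 1/ c     ≡⟨ cong (_* 1/ c) ac≡bc ⟩
  b * c * 1/ c     ≡⟨ sym (cancel b) ⟩
  b                ∎
  where
  open ≡-Reasoning
  instance _ = ℚ.≢-nonZero c≢0
  cancel : ∀ x → x ≡ x * c * 1/ c
  cancel x = sym (trans (ℚP.*-assoc x c (1/ c)) (trans (cong (x *_) (ℚP.*-inverseʳ c)) (ℚP.*-identityʳ x)))

p-q≡0⇒p≡q : ∀ {a b} → a - b ≡ 0ℚ → a ≡ b
p-q≡0⇒p≡q {a} {b} a-b≡0 = begin
  a            ≡⟨ a≡[a-b]+b a b ⟩
  (a - b) + b  ≡⟨ cong (_+ b) a-b≡0 ⟩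
  0ℚ + b       ≡⟨ ℚP.+-identityˡ b ⟩
  b            ∎
  where
  open ≡-Reasoning
  a≡[a-b]+b : ∀ a b → a ≡ (a - b) + b
  a≡[a-b]+b = ℚSolver.solve-∀ ℚ-ring

p≡q⇒p-q≡0 : ∀ {a b} → a ≡ b → a - b ≡ 0ℚ
p≡q⇒p-q≡0 {a} refl = ℚP.+-inverseʳ a

-- x lies in the localisation ℤ₍₃₎ and x ≡ r modulo m ℤ₍₃₎.
infix 4 _≈_[mod_]

record _≈_[mod_] (x : ℚ) (r m : ℤ) : Set where
  constructor fraction
  field
    num den    : ℤ
    3∤den      : 3∤ den
    x*den≡num  : x * q den ≡ q num
    m∣num-rden : m ∣ num ℤ.- r ℤ.* den

q-≈ : ∀ {m} c → q c ≈ c [mod m ]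
q-≈ {m} c = fraction c (+ 1) (from-no (+ 3 ∣? + 1)) (ℚP.*-identityʳ (q c))
  (divides (+ 0) (ℤSolver.solve (c ∷ m ∷ [])))

≈-shift : ∀ {m r s x} → m ∣ r ℤ.- s → x ≈ r [mod m ] → x ≈ s [mod m ]
≈-shift {r = r} {s} m∣r-s (fraction n d 3∤d eq m∣) = fraction n d 3∤d eq
  (∣-resp (∣m∣n⇒∣m+n m∣ (∣m⇒∣m*n d m∣r-s)) (ℤSolver.solve (n ∷ r ∷ s ∷ d ∷ [])))

≈-+ : ∀ {m r s x y} → x ≈ r [mod m ] → y ≈ s [mod m ] → x + y ≈ r ℤ.+ s [mod m ]
≈-+ {r = r} {s} {x} {y} (fraction n₁ d₁ 3∤d₁ e₁ m∣₁) (fraction n₂ d₂ 3∤d₂ e₂ m∣₂) =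
  fraction (n₁ ℤ.* d₂ ℤ.+ n₂ ℤ.* d₁) (d₁ ℤ.* d₂) (3∤-* 3∤d₁ 3∤d₂) eq
    (∣-resp (∣m∣n⇒∣m+n (∣m⇒∣m*n d₂ m∣₁) (∣m⇒∣m*n d₁ m∣₂))
            (ℤSolver.solve (n₁ ∷ n₂ ∷ d₁ ∷ d₂ ∷ r ∷ s ∷ [])))
  where
  open ≡-Reasoning
  identity : ∀ x y a b → (x + y) * (a * b) ≡ (x * a) * b + (y * b) * a
  identity = ℚSolver.solve-∀ ℚ-ring
  eq : (x + y) * q (d₁ ℤ.* d₂) ≡ q (n₁ ℤ.* d₂ ℤ.+ n₂ ℤ.* d₁)
  eq = begin
    (x + y) * q (d₁ ℤ.* d₂)                ≡⟨ cong ((x + y) *_) (q-* d₁ d₂) ⟩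
    (x + y) * (q d₁ * q d₂)                ≡⟨ identity x y (q d₁) (q d₂) ⟩
    (x * q d₁) * q d₂ + (y * q d₂) * q d₁  ≡⟨ cong₂ (λ a b → a * q d₂ + b * q d₁) e₁ e₂ ⟩
    q n₁ * q d₂ + q n₂ * q d₁              ≡⟨ sym (cong₂ _+_ (q-* n₁ d₂) (q-* n₂ d₁)) ⟩
    q (n₁ ℤ.* d₂) + q (n₂ ℤ.* d₁)          ≡⟨ sym (q-+ (n₁ ℤ.* d₂) (n₂ ℤ.* d₁)) ⟩
    q (n₁ ℤ.* d₂ ℤ.+ n₂ ℤ.* d₁)            ∎

≈-* : ∀ {m r s x y} → x ≈ r [mod m ] → y ≈ s [mod m ] → x * y ≈ r ℤ.* s [mod m ]
≈-* {r = r} {s} {x} {y} (fraction n₁ d₁ 3∤d₁ e₁ m∣₁) (fraction n₂ d₂ 3∤d₂ e₂ m∣₂) =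
  fraction (n₁ ℤ.* n₂) (d₁ ℤ.* d₂) (3∤-* 3∤d₁ 3∤d₂) eq
    (∣-resp (∣m∣n⇒∣m+n (∣m⇒∣m*n n₂ m∣₁) (∣m⇒∣m*n (r ℤ.* d₁) m∣₂))
            (ℤSolver.solve (n₁ ∷ n₂ ∷ d₁ ∷ d₂ ∷ r ∷ s ∷ [])))
  where
  open ≡-Reasoning
  identity : ∀ x y a b → (x * y) * (a * b) ≡ (x * a) * (y * b)
  identity = ℚSolver.solve-∀ ℚ-ring
  eq : (x * y) * q (d₁ ℤ.* d₂) ≡ q (n₁ ℤ.* n₂)
  eq = begin
    (x * y) * q (d₁ ℤ.* d₂)  ≡⟨ cong ((x * y) *_) (q-* d₁ d₂) ⟩
    (x * y) * (q d₁ * q d₂)  ≡⟨ identity x y (q d₁) (q d₂) ⟩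
    (x * q d₁) * (y * q d₂)  ≡⟨ cong₂ _*_ e₁ e₂ ⟩
    q n₁ * q n₂              ≡⟨ sym (q-* n₁ n₂) ⟩
    q (n₁ ℤ.* n₂)            ∎

≈-neg : ∀ {m r x} → x ≈ r [mod m ] → - x ≈ ℤ.- r [mod m ]
≈-neg {r = r} {x} (fraction n d 3∤d e m∣) =
  fraction (ℤ.- n) d 3∤d eq (∣-resp (∣m⇒∣-m m∣) (ℤSolver.solve (n ∷ r ∷ d ∷ [])))
  where
  identity : ∀ x a → (- x) * a ≡ - (x * a)
  identity = ℚSolver.solve-∀ ℚ-ring
  eq : (- x) * q d ≡ q (ℤ.- n)
  eq = trans (identity x (q d)) (trans (cong -_ e) (sym (q-neg n)))

≈-- : ∀ {m r s x y} → x ≈ r [mod m ] → y ≈ s [mod m ] → x - y ≈ r ℤ.- s [mod m ]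
≈-- x≈r y≈s = ≈-+ x≈r (≈-neg y≈s)

≈-num-3∤ : ∀ {m r x} → + 3 ∣ m → 3∤ r → (x≈r : x ≈ r [mod m ]) → 3∤ _≈_[mod_].num x≈r
≈-num-3∤ 3∣m 3∤r (fraction n d 3∤d _ m∣) = 3∤-resp (∣-trans 3∣m m∣) (3∤-* 3∤r 3∤d)

≈-3∤⇒≢0 : ∀ {r x} → x ≈ r [mod + 3 ] → 3∤ r → x ≢ 0ℚ
≈-3∤⇒≢0 x≈r@(fraction n d _ e _) 3∤r x≡0 =
  ≈-num-3∤ (divides (+ 1) refl) 3∤r x≈r (divides (+ 0) n≡0)
  where
  n≡0 : n ≡ + 0
  n≡0 = q-injective (trans (sym e) (trans (cong (_* q d) x≡0) (ℚP.*-zeroˡ (q d))))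

≈-unique : ∀ {r s x} → x ≈ r [mod + 3 ] → x ≈ s [mod + 3 ] → + 3 ∣ r ℤ.- s
≈-unique {r} {s} {x} (fraction n₁ d₁ 3∤d₁ e₁ 3∣₁) (fraction n₂ d₂ 3∤d₂ e₂ 3∣₂) =
  3∣-cancelʳ (∣-resp (∣m∣n⇒∣m-n (∣m⇒∣m*n d₁ 3∣₂) (∣m⇒∣m*n d₂ 3∣₁)) (cross-identity n₁≡n₂))
    (3∤-* 3∤d₁ 3∤d₂)
  where
  open ≡-Reasoning
  swap : ∀ x a b → (x * a) * b ≡ (x * b) * a
  swap = ℚSolver.solve-∀ ℚ-ring
  n₁≡n₂ : n₁ ℤ.* d₂ ≡ n₂ ℤ.* d₁
  n₁≡n₂ = q-injective (begin
    q (n₁ ℤ.* d₂)      ≡⟨ q-* n₁ d₂ ⟩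
    q n₁ * q d₂        ≡⟨ cong (_* q d₂) (sym e₁) ⟩
    (x * q d₁) * q d₂  ≡⟨ swap x (q d₁) (q d₂) ⟩
    (x * q d₂) * q d₁  ≡⟨ cong (_* q d₁) e₂ ⟩
    q n₂ * q d₁        ≡⟨ sym (q-* n₂ d₁) ⟩
    q (n₂ ℤ.* d₁)      ∎)
  cross-identity : n₁ ℤ.* d₂ ≡ n₂ ℤ.* d₁ →
    (n₂ ℤ.- s ℤ.* d₂) ℤ.* d₁ ℤ.- (n₁ ℤ.- r ℤ.* d₁) ℤ.* d₂ ≡ (r ℤ.- s) ℤ.* (d₁ ℤ.* d₂)
  cross-identity h = begin
    (n₂ ℤ.- s ℤ.* d₂) ℤ.* d₁ ℤ.- (n₁ ℤ.- r ℤ.* d₁) ℤ.* d₂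
      ≡⟨ ℤSolver.solve (n₁ ∷ n₂ ∷ d₁ ∷ d₂ ∷ r ∷ s ∷ []) ⟩
    (r ℤ.- s) ℤ.* (d₁ ℤ.* d₂) ℤ.+ (n₂ ℤ.* d₁ ℤ.- n₁ ℤ.* d₂)
      ≡⟨ cong (λ a → (r ℤ.- s) ℤ.* (d₁ ℤ.* d₂) ℤ.+ (n₂ ℤ.* d₁ ℤ.- a)) h ⟩
    (r ℤ.- s) ℤ.* (d₁ ℤ.* d₂) ℤ.+ (n₂ ℤ.* d₁ ℤ.- n₂ ℤ.* d₁)
      ≡⟨ ℤSolver.solve (n₂ ∷ d₁ ∷ d₂ ∷ r ∷ s ∷ []) ⟩
    (r ℤ.- s) ℤ.* (d₁ ℤ.* d₂) ∎

≈-incompatible : ∀ {r s x} → x ≈ r [mod + 3 ] → x ≈ s [mod + 3 ] → 3∤ r ℤ.- s → ⊥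
≈-incompatible x≈r x≈s 3∤r-s = 3∤r-s (≈-unique x≈r x≈s)

÷-cross : ∀ {ma mb ra rb a b} l (a≈ra : a ≈ ra [mod ma ]) (b≈rb : b ≈ rb [mod mb ]) → l * a ≡ b →
          l * q (_≈_[mod_].num a≈ra ℤ.* _≈_[mod_].den b≈rb) ≡ q (_≈_[mod_].num b≈rb ℤ.* _≈_[mod_].den a≈ra)
÷-cross {a = a} {b} l (fraction n₁ d₁ _ e₁ _) (fraction n₂ d₂ _ e₂ _) la≡b = begin
  l * q (n₁ ℤ.* d₂)          ≡⟨ cong (l *_) (q-* n₁ d₂) ⟩
  l * (q n₁ * q d₂)          ≡⟨ cong (λ c → l * (c * q d₂)) (sym e₁) ⟩
  l * ((a * q d₁) * q d₂)    ≡⟨ identity l a (q d₁) (q d₂) ⟩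
  ((l * a) * q d₂) * q d₁    ≡⟨ cong (λ c → (c * q d₂) * q d₁) la≡b ⟩
  (b * q d₂) * q d₁          ≡⟨ cong (_* q d₁) e₂ ⟩
  q n₂ * q d₁                ≡⟨ sym (q-* n₂ d₁) ⟩
  q (n₂ ℤ.* d₁)              ∎
  where
  open ≡-Reasoning
  identity : ∀ l a x y → l * ((a * x) * y) ≡ ((l * a) * y) * x
  identity = ℚSolver.solve-∀ ℚ-ring

≈-÷ : ∀ {m ra rb r a b l} → + 3 ∣ m → a ≈ ra [mod m ] → 3∤ ra → b ≈ rb [mod m ] →
      m ∣ r ℤ.* ra ℤ.- rb → l * a ≡ b → l ≈ r [mod m ]
≈-÷ {ra = ra} {rb} {r} {l = l} 3∣m a≈ra@(fraction n₁ d₁ _ _ m∣₁) 3∤ra b≈rb@(fraction n₂ d₂ 3∤d₂ _ m∣₂) m∣ la≡b =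
  fraction (n₂ ℤ.* d₁) (n₁ ℤ.* d₂) (3∤-* (≈-num-3∤ 3∣m 3∤ra a≈ra) 3∤d₂) (÷-cross l a≈ra b≈rb la≡b)
    (∣-resp (∣m∣n⇒∣m-n (∣m∣n⇒∣m-n (∣m⇒∣m*n d₁ m∣₂) (∣m⇒∣m*n (r ℤ.* d₂) m∣₁)) (∣m⇒∣m*n (d₁ ℤ.* d₂) m∣))
            (ℤSolver.solve (n₁ ∷ n₂ ∷ d₁ ∷ d₂ ∷ r ∷ ra ∷ rb ∷ [])))

≈0-÷ : ∀ {m ra a b l} → a ≈ ra [mod + 3 ] → 3∤ ra → b ≈ + 0 [mod m ] → l * a ≡ b → l ≈ + 0 [mod m ]
≈0-÷ {l = l} a≈ra@(fraction n₁ d₁ _ _ _) 3∤ra b≈0@(fraction n₂ d₂ 3∤d₂ _ m∣₂) la≡b =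
  fraction (n₂ ℤ.* d₁) (n₁ ℤ.* d₂) (3∤-* (≈-num-3∤ (divides (+ 1) refl) 3∤ra a≈ra) 3∤d₂) (÷-cross l a≈ra b≈0 la≡b)
    (∣-resp (∣m⇒∣m*n d₁ m∣₂) (ℤSolver.solve (n₁ ∷ n₂ ∷ d₁ ∷ d₂ ∷ [])))

≈0-3* : ∀ {x} → x ≈ + 0 [mod + 3 ] → q (+ 3) * x ≈ + 0 [mod + 9 ]
≈0-3* {x} (fraction n d 3∤d e 3∣n) =
  fraction (+ 3 ℤ.* n) d 3∤d eq (∣-resp (*-monoʳ-∣ (+ 3) 3∣n) (identity n d))
  where
  identity : ∀ n d → + 3 ℤ.* (n ℤ.- + 0 ℤ.* d) ≡ + 3 ℤ.* n ℤ.- + 0 ℤ.* d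
  identity = ℤSolver.solve-∀
  eq : q (+ 3) * x * q d ≡ q (+ 3 ℤ.* n)
  eq = trans (ℚP.*-assoc (q (+ 3)) x (q d)) (trans (cong (q (+ 3) *_) e) (sym (q-* (+ 3) n)))

vℕ-3∤ : ∀ {n} → ¬ (3 ℕDiv.∣ n) → vℕ 3 n ≡ 0
vℕ-3∤ {zero} _ = refl
vℕ-3∤ {suc n} 3∤n with 3 ℕDiv.∣? suc n
... | yes 3∣n = ⊥-elim (3∤n 3∣n)
... | no _ = refl

vℕ-go≥1 : ∀ f n → 3 ℕDiv.∣ suc n → 1 ℕ.≤ vℕ-go 3 (suc f) (suc n)
vℕ-go≥1 f n 3∣n with 3 ℕDiv.∣? suc n
... | yes _ = s≤s z≤n
... | no 3∤n = ⊥-elim (3∤n 3∣n)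

vℕ≥1 : ∀ {n} → n ≢ 0 → 3 ℕDiv.∣ n → 1 ℕ.≤ vℕ 3 n
vℕ≥1 {zero} n≢0 _ = ⊥-elim (n≢0 refl)
vℕ≥1 {suc n} _ = vℕ-go≥1 n n

vℕ[9k]≥2 : ∀ k → 2 ℕ.≤ vℕ 3 (suc k ℕ.* 9)
vℕ[9k]≥2 k with 3 ℕDiv.∣? (suc k ℕ.* 9)
... | no 3∤9k = ⊥-elim (3∤9k (ℕDiv.divides (suc k ℕ.* 3) (sym (ℕP.*-assoc (suc k) 3 3))))
... | yes _ = s≤s (subst (λ n → 1 ℕ.≤ vℕ-go 3 (8 ℕ.+ k ℕ.* 9) n) (sym 9k/3≡3k)
                   (vℕ-go≥1 (7 ℕ.+ k ℕ.* 9) (2 ℕ.+ k ℕ.* 3) (ℕDiv.divides (suc k) refl)))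
  where
  9k/3≡3k : suc k ℕ.* 9 ℕ./ 3 ≡ 3 ℕ.+ k ℕ.* 3
  9k/3≡3k = trans (cong (ℕ._/ 3) (sym (ℕP.*-assoc (suc k) 3 3))) (ℕDivMod.m*n/n≡m (suc k ℕ.* 3) 3)

vℕ≥2 : ∀ {n} → n ≢ 0 → 9 ℕDiv.∣ n → 2 ℕ.≤ vℕ 3 n
vℕ≥2 n≢0 (ℕDiv.divides zero refl) = ⊥-elim (n≢0 refl)
vℕ≥2 _ (ℕDiv.divides (suc k) refl) = vℕ[9k]≥2 k

v₃-≥ : ∀ {x} n → ¬ (3 ℕDiv.∣ ↧ₙ x) → (x ≢ 0ℚ → n ℕ.≤ vℕ 3 ℤ.∣ ↥ x ∣) → v 3 x ≥ᵥ + n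
v₃-≥ {x} n 3∤↧ bound with x ℚP.≟ 0ℚ
... | yes _ = tt
... | no x≢0 rewrite vℕ-3∤ 3∤↧ = ℤ.+≤+ (ℕP.≤-trans (bound x≢0) (ℕP.m≤m+n _ 0))

↥≢0 : ∀ {x} → x ≢ 0ℚ → ℤ.∣ ↥ x ∣ ≢ 0
↥≢0 {x} x≢0 ∣↥x∣≡0 = x≢0 (ℚP.↥p≡0⇒p≡0 x (ℤP.∣i∣≡0⇒i≡0 ∣↥x∣≡0))

¬3∣↥∧↧ : ∀ x → + 3 ∣ ↥ x → + 3 ∣ ↧ x → ⊥
¬3∣↥∧↧ (mkℚ _ _ coprime) 3∣↥ 3∣↧ with Coprimality.recompute coprime (∣⇒∣ᵤ 3∣↥ , ∣⇒∣ᵤ 3∣↧)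
... | ()

module _ {m r x} (x≈r : x ≈ r [mod m ]) where
  open _≈_[mod_] x≈r

  ↥*den≡num*↧ : ↥ x ℤ.* den ≡ num ℤ.* ↧ x
  ↥*den≡num*↧ = q-injective (begin
    q (↥ x ℤ.* den)        ≡⟨ q-* (↥ x) den ⟩
    q (↥ x) * q den        ≡⟨ cong (_* q den) (sym (q-↧*≡↥ x)) ⟩
    x * q (↧ x) * q den    ≡⟨ swap x (q (↧ x)) (q den) ⟩
    x * q den * q (↧ x)    ≡⟨ cong (_* q (↧ x)) x*den≡num ⟩
    q num * q (↧ x)        ≡⟨ sym (q-* num (↧ x)) ⟩
    q (num ℤ.* ↧ x)        ∎)
    where
    open ≡-Reasoning
    swap : ∀ a b c → a * b * c ≡ a * c * b
    swap = ℚSolver.solve-∀ ℚ-ring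

  3∤↧ : ¬ (3 ℕDiv.∣ ↧ₙ x)
  3∤↧ 3∣↧ = ¬3∣↥∧↧ x (3∣-cancelʳ {↥ x} 3∣↥*den 3∤den) (∣ᵤ⇒∣ 3∣↧)
    where
    3∣↥*den : + 3 ∣ ↥ x ℤ.* den
    3∣↥*den = ∣-resp (∣n⇒∣m*n num (∣ᵤ⇒∣ {+ 3} {↧ x} 3∣↧)) (sym ↥*den≡num*↧)

  3∤↥ : + 3 ∣ m → 3∤ r → ¬ (3 ℕDiv.∣ ℤ.∣ ↥ x ∣)
  3∤↥ 3∣m 3∤r 3∣↥ = ¬3∣↥∧↧ x (∣ᵤ⇒∣ 3∣↥) (3∣-cancelʳ {↧ x} 3∣↧*num (≈-num-3∤ 3∣m 3∤r x≈r))
    where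
    3∣↧*num : + 3 ∣ ↧ x ℤ.* num
    3∣↧*num = ∣-resp (∣m⇒∣m*n den (∣ᵤ⇒∣ {+ 3} {↥ x} 3∣↥)) (trans ↥*den≡num*↧ (ℤP.*-comm num (↧ x)))

  ∣num⇒∣↥*den : ∀ {k} → k ∣ num → k ∣ ↥ x ℤ.* den
  ∣num⇒∣↥*den k∣num = ∣-resp (∣m⇒∣m*n (↧ x) k∣num) (sym ↥*den≡num*↧)

v₃-unit : ∀ {r x} → x ≈ r [mod + 3 ] → 3∤ r → v 3 x ≡ just (+ 0)
v₃-unit {r} {x} x≈r 3∤r with x ℚP.≟ 0ℚ
... | yes x≡0 = ⊥-elim (≈-3∤⇒≢0 x≈r 3∤r x≡0)
... | no _ = cong₂ (λ a b → just (+ a ℤ.- + b)) (vℕ-3∤ (3∤↥ x≈r (divides (+ 1) refl) 3∤r)) (vℕ-3∤ (3∤↧ x≈r))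

n-0*d≡n : ∀ n d → n ℤ.- + 0 ℤ.* d ≡ n
n-0*d≡n = ℤSolver.solve-∀

v₃≥1 : ∀ {x} → x ≈ + 0 [mod + 3 ] → v 3 x ≥ᵥ + 1
v₃≥1 {x} x≈0@(fraction n d 3∤d _ 3∣n) = v₃-≥ 1 (3∤↧ x≈0) λ x≢0 →
  vℕ≥1 (↥≢0 x≢0) (∣⇒∣ᵤ (3∣-cancelʳ {↥ x} (∣num⇒∣↥*den x≈0 (∣-resp 3∣n (n-0*d≡n n d))) 3∤d))

v₃≥2 : ∀ {x} → x ≈ + 0 [mod + 9 ] → v 3 x ≥ᵥ + 2
v₃≥2 {x} x≈0@(fraction n d 3∤d _ 9∣n) = v₃-≥ 2 (3∤↧ x≈0) λ x≢0 →
  vℕ≥2 (↥≢0 x≢0) (∣⇒∣ᵤ (9∣-cancelʳ {↥ x} (∣num⇒∣↥*den x≈0 (∣-resp 9∣n (n-0*d≡n n d))) 3∤d))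

OnCurve : ℚ → ℚ → Set
OnCurve x y = y * y ≡ x * x * x + q (+ 9) * x

module Chord {x y : ℚ} (4≢x : q (+ 4) ≢ x) where
  open ≡-Reasoning

  x-4≢0 : x - q (+ 4) ≢ 0ℚ
  x-4≢0 x-4≡0 = 4≢x (sym (p-q≡0⇒p≡q x-4≡0))

  slope : ℚ
  slope = (y - q (+ 10)) // (x - q (+ 4))

  slope*[x-4] : slope * (x - q (+ 4)) ≡ y - q (+ 10)
  slope*[x-4] = //-*-cancel (y - q (+ 10)) x-4≢0

  x₃ y₃ : ℚ
  x₃ = slope * slope - q (+ 4) - x
  y₃ = slope * (q (+ 4) - x₃) - q (+ 10)

  -- (x - 4) times the curve equation at (x₃ , y₃) is a combination of the curve
  -- equation at (x , y) and the defining equation of the slope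
  on-curve : OnCurve x y → OnCurve x₃ y₃
  on-curve on = sym (p-q≡0⇒p≡q (*-cancelʳ-≡ (x - q (+ 4)) x-4≢0 (begin
    (x₃ * x₃ * x₃ + q (+ 9) * x₃ - y₃ * y₃) * (x - q (+ 4))
      ≡⟨ identity slope x y ⟩
    (x₃ - q (+ 4)) * ((x * x * x + q (+ 9) * x - y * y)
      + ((y - q (+ 10)) - slope * (x - q (+ 4))) * (y + slope * (x - q (+ 4)) + q (+ 10)))
      ≡⟨ cong₂ (λ a b → (x₃ - q (+ 4)) * (a + b * (y + slope * (x - q (+ 4)) + q (+ 10))))
               (p≡q⇒p-q≡0 (sym on)) (p≡q⇒p-q≡0 (sym slope*[x-4])) ⟩
    (x₃ - q (+ 4)) * (0ℚ + 0ℚ * (y + slope * (x - q (+ 4)) + q (+ 10)))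
      ≡⟨ vanish (x₃ - q (+ 4)) (y + slope * (x - q (+ 4)) + q (+ 10)) (x - q (+ 4)) ⟩
    0ℚ * (x - q (+ 4)) ∎)))
    where
    identity : ∀ l x y →
      ((l * l - q (+ 4) - x) * (l * l - q (+ 4) - x) * (l * l - q (+ 4) - x) + q (+ 9) * (l * l - q (+ 4) - x)
        - (l * (q (+ 4) - (l * l - q (+ 4) - x)) - q (+ 10)) * (l * (q (+ 4) - (l * l - q (+ 4) - x)) - q (+ 10)))
        * (x - q (+ 4))
      ≡ ((l * l - q (+ 4) - x) - q (+ 4)) * ((x * x * x + q (+ 9) * x - y * y)
          + ((y - q (+ 10)) - l * (x - q (+ 4))) * (y + l * (x - q (+ 4)) + q (+ 10)))
    identity = ℚSolver.solve-∀ ℚ-ring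
    vanish : ∀ a b c → a * (0ℚ + 0ℚ * b) ≡ 0ℚ * c
    vanish = ℚSolver.solve-∀ ℚ-ring

-- The reduction modulo 3 of P is the point (1 , s) of the cuspidal cubic y² = x³.
data ReducesTo[1,_] (s : ℤ) : Point → Set where
  reduction : ∀ {x y} → OnCurve x y → x ≈ + 1 [mod + 3 ] → y ≈ s [mod + 3 ] → ReducesTo[1, s ] (aff x y)

-- The reduction modulo 3 of P is the point at infinity, witnessed by the local
-- coordinates u = 1/x and w = x/y at infinity being divisible by 3.
data ReducesTo∞ : Point → Set where
  at-O : ReducesTo∞ O
  reduction : ∀ {x y u w} → OnCurve x y → u * x ≡ q (+ 1) → w * y ≡ x →
              u ≈ + 0 [mod + 3 ] → w ≈ + 0 [mod + 3 ] → ReducesTo∞ (aff x y)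

T-reduction : ReducesTo[1, + 1 ] T
T-reduction = reduction refl (≈-shift (divides (+ 1) refl) (q-≈ (+ 4))) (≈-shift (divides (+ 3) refl) (q-≈ (+ 10)))

2T-reduction : ReducesTo[1, ℤ.- + 1 ] ([ 2 ] T)
2T-reduction = reduction refl
  (fraction (+ 49) (+ 400) (from-no (+ 3 ∣? + 400)) refl (divides -[1+ 116 ] refl))
  (fraction (+ 8407) (+ 8000) (from-no (+ 3 ∣? + 8000)) refl (divides (+ 5469) refl))

T⊕[1,1] : ∀ {P} → ReducesTo[1, + 1 ] P → ReducesTo[1, ℤ.- + 1 ] (T ⊕ P)
T⊕[1,1] (reduction {x} {y} on x≈1 y≈1) with q (+ 4) ℚP.≟ x
... | no 4≢x = reduction (on-curve on) x₃≈1 y₃≈-1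
  where
  open ≡-Reasoning
  open Chord {x} {y} 4≢x
  identity : ∀ l x y → (l * (y + q (+ 10))) * (x - q (+ 4)) ≡ (l * (x - q (+ 4))) * (y + q (+ 10))
  identity = ℚSolver.solve-∀ ℚ-ring
  y²-100 : ∀ y → (y - q (+ 10)) * (y + q (+ 10)) ≡ y * y - q (+ 100)
  y²-100 = ℚSolver.solve-∀ ℚ-ring
  factor : ∀ x → (x * x * x + q (+ 9) * x) - q (+ 100) ≡ (x * x + q (+ 4) * x + q (+ 25)) * (x - q (+ 4))
  factor = ℚSolver.solve-∀ ℚ-ring
  -- the slope is also (x² + 4x + 25) / (y + 10), whose denominator is prime to 3
  slope*[y+10] : slope * (y + q (+ 10)) ≡ x * x + q (+ 4) * x + q (+ 25)
  slope*[y+10] = *-cancelʳ-≡ (x - q (+ 4)) x-4≢0 (begin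
    (slope * (y + q (+ 10))) * (x - q (+ 4))     ≡⟨ identity slope x y ⟩
    (slope * (x - q (+ 4))) * (y + q (+ 10))     ≡⟨ cong (_* (y + q (+ 10))) slope*[x-4] ⟩
    (y - q (+ 10)) * (y + q (+ 10))              ≡⟨ y²-100 y ⟩
    y * y - q (+ 100)                            ≡⟨ cong (_- q (+ 100)) on ⟩
    (x * x * x + q (+ 9) * x) - q (+ 100)        ≡⟨ factor x ⟩
    (x * x + q (+ 4) * x + q (+ 25)) * (x - q (+ 4)) ∎)
  slope≈0 : slope ≈ + 0 [mod + 3 ]
  slope≈0 = ≈-÷ (divides (+ 1) refl) (≈-+ y≈1 (q-≈ (+ 10))) (from-no (+ 3 ∣? + 11))
              (≈-+ (≈-+ (≈-* x≈1 x≈1) (≈-* (q-≈ (+ 4)) x≈1)) (q-≈ (+ 25)))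
              (divides -[1+ 9 ] refl) slope*[y+10]
  x₃≈1 : x₃ ≈ + 1 [mod + 3 ]
  x₃≈1 = ≈-shift (divides -[1+ 1 ] refl) (≈-- (≈-- (≈-* slope≈0 slope≈0) (q-≈ (+ 4))) x≈1)
  y₃≈-1 : y₃ ≈ ℤ.- + 1 [mod + 3 ]
  y₃≈-1 = ≈-shift (divides -[1+ 2 ] refl) (≈-- (≈-* slope≈0 (≈-- (q-≈ (+ 4)) x₃≈1)) (q-≈ (+ 10)))
... | yes _ with q (+ 10) ℚP.≟ - y
...   | yes 10≡-y = ⊥-elim (≈-incompatible (≈-neg y≈1) -y≈10 (from-no (+ 3 ∣? -[1+ 10 ])))
  where
  -y≈10 : - y ≈ + 10 [mod + 3 ]
  -y≈10 = subst (_≈ + 10 [mod + 3 ]) 10≡-y (q-≈ (+ 10))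
...   | no _ = 2T-reduction

module Chord[1,-1] {x y : ℚ} (4≢x : q (+ 4) ≢ x) (on : OnCurve x y)
                   (x≈1 : x ≈ + 1 [mod + 3 ]) (y≈-1 : y ≈ ℤ.- + 1 [mod + 3 ]) where
  open ≡-Reasoning
  open Chord {x} {y} 4≢x

  assoc : ∀ a b c → (a * b) * c ≡ a * (b * c)
  assoc = ℚSolver.solve-∀ ℚ-ring
  1*-identity : ∀ a → a ≡ q (+ 1) * a
  1*-identity = ℚSolver.solve-∀ ℚ-ring

  y-10≈-11 : y - q (+ 10) ≈ ℤ.- + 11 [mod + 3 ]
  y-10≈-11 = ≈-- y≈-1 (q-≈ (+ 10))

  y-10≢0 : y - q (+ 10) ≢ 0ℚ
  y-10≢0 = ≈-3∤⇒≢0 y-10≈-11 (from-no (+ 3 ∣? ℤ.- + 11))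

  -- μ = 1 / slope; it is divisible by 3, so the chord meets the curve again near infinity
  μ : ℚ
  μ = (x - q (+ 4)) // (y - q (+ 10))

  μ*[y-10] : μ * (y - q (+ 10)) ≡ x - q (+ 4)
  μ*[y-10] = //-*-cancel (x - q (+ 4)) y-10≢0

  slope*μ : slope * μ ≡ q (+ 1)
  slope*μ = *-cancelʳ-≡ (y - q (+ 10)) y-10≢0 (begin
    (slope * μ) * (y - q (+ 10))  ≡⟨ assoc slope μ (y - q (+ 10)) ⟩
    slope * (μ * (y - q (+ 10)))  ≡⟨ cong (slope *_) μ*[y-10] ⟩
    slope * (x - q (+ 4))         ≡⟨ slope*[x-4] ⟩
    y - q (+ 10)                  ≡⟨ 1*-identity (y - q (+ 10)) ⟩
    q (+ 1) * (y - q (+ 10))      ∎)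

  μ≈0 : μ ≈ + 0 [mod + 3 ]
  μ≈0 = ≈-÷ (divides (+ 1) refl) y-10≈-11 (from-no (+ 3 ∣? ℤ.- + 11)) (≈-- x≈1 (q-≈ (+ 4)))
          (divides (+ 1) refl) μ*[y-10]

  N : ℚ
  N = q (+ 1) - (q (+ 4) + x) * μ * μ

  N≈1 : N ≈ + 1 [mod + 3 ]
  N≈1 = ≈-- (q-≈ (+ 1)) (≈-* (≈-* (≈-+ (q-≈ (+ 4)) x≈1) μ≈0) μ≈0)

  x₃*μ² : x₃ * (μ * μ) ≡ N
  x₃*μ² = begin
    x₃ * (μ * μ)                                           ≡⟨ expand slope x μ ⟩
    (slope * μ) * (slope * μ) - (q (+ 4) + x) * μ * μ      ≡⟨ cong (λ a → a * a - (q (+ 4) + x) * μ * μ) slope*μ ⟩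
    q (+ 1) * q (+ 1) - (q (+ 4) + x) * μ * μ              ≡⟨ simplify x μ ⟩
    N                                                      ∎
    where
    expand : ∀ l x m → (l * l - q (+ 4) - x) * (m * m) ≡ (l * m) * (l * m) - (q (+ 4) + x) * m * m
    expand = ℚSolver.solve-∀ ℚ-ring
    simplify : ∀ x m → q (+ 1) * q (+ 1) - (q (+ 4) + x) * m * m ≡ q (+ 1) - (q (+ 4) + x) * m * m
    simplify = ℚSolver.solve-∀ ℚ-ring

  x₃≢0 : x₃ ≢ 0ℚ
  x₃≢0 x₃≡0 = ≈-3∤⇒≢0 N≈1 (from-no (+ 3 ∣? + 1))
    (trans (sym x₃*μ²) (trans (cong (_* (μ * μ)) x₃≡0) (ℚP.*-zeroˡ (μ * μ))))

  u₃ : ℚ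
  u₃ = q (+ 1) // x₃

  u₃*x₃ : u₃ * x₃ ≡ q (+ 1)
  u₃*x₃ = //-*-cancel (q (+ 1)) x₃≢0

  u₃≈0 : u₃ ≈ + 0 [mod + 3 ]
  u₃≈0 = ≈0-÷ N≈1 (from-no (+ 3 ∣? + 1)) (≈-* μ≈0 μ≈0) (begin
    u₃ * N                 ≡⟨ cong (u₃ *_) (sym x₃*μ²) ⟩
    u₃ * (x₃ * (μ * μ))    ≡⟨ sym (assoc u₃ x₃ (μ * μ)) ⟩
    (u₃ * x₃) * (μ * μ)    ≡⟨ cong (_* (μ * μ)) u₃*x₃ ⟩
    q (+ 1) * (μ * μ)      ≡⟨ sym (1*-identity (μ * μ)) ⟩
    μ * μ                  ∎)

  M : ℚ
  M = q (+ 4) * μ * μ - N - q (+ 10) * μ * μ * μ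

  M≈-1 : M ≈ ℤ.- + 1 [mod + 3 ]
  M≈-1 = ≈-- (≈-- (≈-* (≈-* (q-≈ (+ 4)) μ≈0) μ≈0) N≈1) (≈-* (≈-* (≈-* (q-≈ (+ 10)) μ≈0) μ≈0) μ≈0)

  y₃*μ³ : y₃ * (μ * μ * μ) ≡ M
  y₃*μ³ = begin
    y₃ * (μ * μ * μ)                                             ≡⟨ expand slope μ x₃ ⟩
    (slope * μ) * (μ * μ * (q (+ 4) - x₃)) - q (+ 10) * μ * μ * μ ≡⟨ cong (λ a → a * (μ * μ * (q (+ 4) - x₃)) - q (+ 10) * μ * μ * μ) slope*μ ⟩
    q (+ 1) * (μ * μ * (q (+ 4) - x₃)) - q (+ 10) * μ * μ * μ     ≡⟨ simplify μ x₃ ⟩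
    q (+ 4) * μ * μ - x₃ * (μ * μ) - q (+ 10) * μ * μ * μ        ≡⟨ cong (λ a → q (+ 4) * μ * μ - a - q (+ 10) * μ * μ * μ) x₃*μ² ⟩
    M                                                           ∎
    where
    expand : ∀ l m a → (l * (q (+ 4) - a) - q (+ 10)) * (m * m * m) ≡ (l * m) * (m * m * (q (+ 4) - a)) - q (+ 10) * m * m * m
    expand = ℚSolver.solve-∀ ℚ-ring
    simplify : ∀ m a → q (+ 1) * (m * m * (q (+ 4) - a)) - q (+ 10) * m * m * m ≡ q (+ 4) * m * m - a * (m * m) - q (+ 10) * m * m * m
    simplify = ℚSolver.solve-∀ ℚ-ring

  y₃≢0 : y₃ ≢ 0ℚ
  y₃≢0 y₃≡0 = ≈-3∤⇒≢0 M≈-1 (from-no (+ 3 ∣? ℤ.- + 1))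
    (trans (sym y₃*μ³) (trans (cong (_* (μ * μ * μ)) y₃≡0) (ℚP.*-zeroˡ (μ * μ * μ))))

  w₃ : ℚ
  w₃ = x₃ // y₃

  w₃*y₃ : w₃ * y₃ ≡ x₃
  w₃*y₃ = //-*-cancel x₃ y₃≢0

  w₃≈0 : w₃ ≈ + 0 [mod + 3 ]
  w₃≈0 = ≈0-÷ M≈-1 (from-no (+ 3 ∣? ℤ.- + 1)) (≈-* N≈1 μ≈0) (begin
    w₃ * M                    ≡⟨ cong (w₃ *_) (sym y₃*μ³) ⟩
    w₃ * (y₃ * (μ * μ * μ))   ≡⟨ regroup w₃ y₃ μ ⟩
    (w₃ * y₃) * (μ * μ) * μ   ≡⟨ cong (λ a → a * (μ * μ) * μ) w₃*y₃ ⟩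
    x₃ * (μ * μ) * μ          ≡⟨ cong (_* μ) x₃*μ² ⟩
    N * μ                     ∎)
    where
    regroup : ∀ w y m → w * (y * (m * m * m)) ≡ (w * y) * (m * m) * m
    regroup = ℚSolver.solve-∀ ℚ-ring

  reduces : ReducesTo∞ (aff x₃ y₃)
  reduces = reduction (on-curve on) u₃*x₃ w₃*y₃ u₃≈0 w₃≈0

on-curve-at-4 : ∀ {y} → OnCurve (q (+ 4)) y → q (+ 10) ≢ - y → y ≡ q (+ 10)
on-curve-at-4 {y} on 10≢-y = p-q≡0⇒p≡q (*-cancelʳ-≡ (y + q (+ 10)) y+10≢0 (begin
  (y - q (+ 10)) * (y + q (+ 10))  ≡⟨ y²-100 y ⟩
  y * y - q (+ 100)                ≡⟨ cong (_- q (+ 100)) on ⟩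
  0ℚ                               ≡⟨ sym (ℚP.*-zeroˡ (y + q (+ 10))) ⟩
  0ℚ * (y + q (+ 10))              ∎))
  where
  open ≡-Reasoning
  y²-100 : ∀ y → (y - q (+ 10)) * (y + q (+ 10)) ≡ y * y - q (+ 100)
  y²-100 = ℚSolver.solve-∀ ℚ-ring
  10≡[y+10]-y : ∀ y → q (+ 10) ≡ (y + q (+ 10)) - y
  10≡[y+10]-y = ℚSolver.solve-∀ ℚ-ring
  y+10≢0 : y + q (+ 10) ≢ 0ℚ
  y+10≢0 y+10≡0 = 10≢-y (trans (10≡[y+10]-y y) (trans (cong (_- y) y+10≡0) (ℚP.+-identityˡ (- y))))

T⊕[1,-1] : ∀ {P} → ReducesTo[1, ℤ.- + 1 ] P → ReducesTo∞ (T ⊕ P)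
T⊕[1,-1] (reduction {x} {y} on x≈1 y≈-1) with q (+ 4) ℚP.≟ x
... | no 4≢x = Chord[1,-1].reduces 4≢x on x≈1 y≈-1
... | yes refl with q (+ 10) ℚP.≟ - y
...   | yes _ = at-O
...   | no 10≢-y = ⊥-elim (≈-incompatible y≈10 y≈-1 (from-no (+ 3 ∣? + 11)))
  where
  y≈10 : y ≈ + 10 [mod + 3 ]
  y≈10 = subst (_≈ + 10 [mod + 3 ]) (sym (on-curve-at-4 on 10≢-y)) (q-≈ (+ 10))

u≡w²[1+9u²] : ∀ {x y u w} → OnCurve x y → u * x ≡ q (+ 1) → w * y ≡ x →
              u ≡ w * w * (q (+ 1) + q (+ 9) * u * u)
u≡w²[1+9u²] {x} {y} {u} {w} on u*x≡1 w*y≡x = sym (begin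
  w * w * (q (+ 1) + q (+ 9) * u * u)
    ≡⟨ expand w u x ⟩
  w * w * (x * x * x + q (+ 9) * x) * (u * u * u) + w * w * (q (+ 1) - (u * x) * (u * x) * (u * x))
    + q (+ 9) * w * w * u * u * (q (+ 1) - u * x)
    ≡⟨ cong₂ (λ a b → w * w * a * (u * u * u) + w * w * (q (+ 1) - b * b * b) + q (+ 9) * w * w * u * u * (q (+ 1) - b))
             (sym on) u*x≡1 ⟩
  w * w * (y * y) * (u * u * u) + w * w * (q (+ 1) - q (+ 1) * q (+ 1) * q (+ 1))
    + q (+ 9) * w * w * u * u * (q (+ 1) - q (+ 1))
    ≡⟨ simplify w y u ⟩
  (w * y) * (w * y) * (u * u * u)  ≡⟨ cong (λ a → a * a * (u * u * u)) w*y≡x ⟩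
  x * x * (u * u * u)              ≡⟨ regroup x u ⟩
  (u * x) * (u * x) * u            ≡⟨ cong (λ a → a * a * u) u*x≡1 ⟩
  q (+ 1) * q (+ 1) * u            ≡⟨ 1*1*-identity u ⟩
  u                                ∎)
  where
  open ≡-Reasoning
  expand : ∀ w u x → w * w * (q (+ 1) + q (+ 9) * u * u) ≡
    w * w * (x * x * x + q (+ 9) * x) * (u * u * u) + w * w * (q (+ 1) - (u * x) * (u * x) * (u * x))
      + q (+ 9) * w * w * u * u * (q (+ 1) - u * x)
  expand = ℚSolver.solve-∀ ℚ-ring
  simplify : ∀ w y u → w * w * (y * y) * (u * u * u) + w * w * (q (+ 1) - q (+ 1) * q (+ 1) * q (+ 1))
    + q (+ 9) * w * w * u * u * (q (+ 1) - q (+ 1)) ≡ (w * y) * (w * y) * (u * u * u)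
  simplify = ℚSolver.solve-∀ ℚ-ring
  regroup : ∀ x u → x * x * (u * u * u) ≡ (u * x) * (u * x) * u
  regroup = ℚSolver.solve-∀ ℚ-ring
  1*1*-identity : ∀ u → q (+ 1) * q (+ 1) * u ≡ u
  1*1*-identity = ℚSolver.solve-∀ ℚ-ring

module Chord[∞] {x y u w : ℚ} (4≢x : q (+ 4) ≢ x) (on : OnCurve x y)
                (u*x≡1 : u * x ≡ q (+ 1)) (w*y≡x : w * y ≡ x)
                (u≈0 : u ≈ + 0 [mod + 3 ]) (w≈0 : w ≈ + 0 [mod + 3 ]) where
  open ≡-Reasoning
  open Chord {x} {y} 4≢x

  A G L : ℚ
  A = q (+ 1) - q (+ 4) * u
  G = q (+ 1) + q (+ 9) * u * u
  L = slope * w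

  A≈1 : A ≈ + 1 [mod + 3 ]
  A≈1 = ≈-- (q-≈ (+ 1)) (≈-* (q-≈ (+ 4)) u≈0)

  G≈1 : G ≈ + 1 [mod + 3 ]
  G≈1 = ≈-+ (q-≈ (+ 1)) (≈-* (≈-* (q-≈ (+ 9)) u≈0) u≈0)

  u≡w²G : u ≡ w * w * G
  u≡w²G = u≡w²[1+9u²] {y = y} {w = w} on u*x≡1 w*y≡x

  L*A : L * A ≡ q (+ 1) - q (+ 10) * u * w
  L*A = begin
    L * (q (+ 1) - q (+ 4) * u)      ≡⟨ cong (λ a → L * (a - q (+ 4) * u)) (sym u*x≡1) ⟩
    L * (u * x - q (+ 4) * u)        ≡⟨ regroup slope w u x ⟩
    (w * u) * (slope * (x - q (+ 4))) ≡⟨ cong ((w * u) *_) slope*[x-4] ⟩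
    (w * u) * (y - q (+ 10))         ≡⟨ expand w u y ⟩
    u * (w * y) - q (+ 10) * u * w   ≡⟨ cong (λ a → u * a - q (+ 10) * u * w) w*y≡x ⟩
    u * x - q (+ 10) * u * w         ≡⟨ cong (_- q (+ 10) * u * w) u*x≡1 ⟩
    q (+ 1) - q (+ 10) * u * w       ∎
    where
    regroup : ∀ l w u x → l * w * (u * x - q (+ 4) * u) ≡ (w * u) * (l * (x - q (+ 4)))
    regroup = ℚSolver.solve-∀ ℚ-ring
    expand : ∀ w u y → (w * u) * (y - q (+ 10)) ≡ u * (w * y) - q (+ 10) * u * w
    expand = ℚSolver.solve-∀ ℚ-ring

  L≈1 : L ≈ + 1 [mod + 3 ]
  L≈1 = ≈-÷ (divides (+ 1) refl) A≈1 (from-no (+ 3 ∣? + 1))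
          (≈-- (q-≈ (+ 1)) (≈-* (≈-* (q-≈ (+ 10)) u≈0) w≈0)) (divides (+ 0) refl) L*A

  -- L ≡ 1 to first order in u: this is what lets x₃ u = L² G - 4u - 1 be divided by u
  [L-1]*A : (L - q (+ 1)) * A ≡ u * (q (+ 4) - q (+ 10) * w)
  [L-1]*A = begin
    (L - q (+ 1)) * A                   ≡⟨ expand L u ⟩
    L * A - A                           ≡⟨ cong (_- A) L*A ⟩
    (q (+ 1) - q (+ 10) * u * w) - A    ≡⟨ simplify u w ⟩
    u * (q (+ 4) - q (+ 10) * w)        ∎
    where
    expand : ∀ L u → (L - q (+ 1)) * (q (+ 1) - q (+ 4) * u) ≡ L * (q (+ 1) - q (+ 4) * u) - (q (+ 1) - q (+ 4) * u)
    expand = ℚSolver.solve-∀ ℚ-ring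
    simplify : ∀ u w → (q (+ 1) - q (+ 10) * u * w) - (q (+ 1) - q (+ 4) * u) ≡ u * (q (+ 4) - q (+ 10) * w)
    simplify = ℚSolver.solve-∀ ℚ-ring

  x₃*u : x₃ * u ≡ L * L * G - q (+ 4) * u - q (+ 1)
  x₃*u = begin
    x₃ * u                                         ≡⟨ expand slope x u ⟩
    slope * slope * u - q (+ 4) * u - u * x        ≡⟨ cong (λ a → slope * slope * u - q (+ 4) * u - a) u*x≡1 ⟩
    slope * slope * u - q (+ 4) * u - q (+ 1)      ≡⟨ cong (λ a → slope * slope * a - q (+ 4) * u - q (+ 1)) u≡w²G ⟩
    slope * slope * (w * w * G) - q (+ 4) * u - q (+ 1) ≡⟨ regroup slope w G u ⟩
    L * L * G - q (+ 4) * u - q (+ 1)              ∎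
    where
    expand : ∀ l x u → (l * l - q (+ 4) - x) * u ≡ l * l * u - q (+ 4) * u - u * x
    expand = ℚSolver.solve-∀ ℚ-ring
    regroup : ∀ l w g u → l * l * (w * w * g) - q (+ 4) * u - q (+ 1) ≡ (l * w) * (l * w) * g - q (+ 4) * u - q (+ 1)
    regroup = ℚSolver.solve-∀ ℚ-ring

  u≢0 : u ≢ 0ℚ
  u≢0 u≡0 with trans (sym u*x≡1) (trans (cong (_* x) u≡0) (ℚP.*-zeroˡ x))
  ... | ()

  R : ℚ
  R = (L + q (+ 1)) * (q (+ 4) - q (+ 10) * w) * G + (q (+ 9) * u - q (+ 4)) * A

  R≈4 : R ≈ + 4 [mod + 3 ]
  R≈4 = ≈-+ (≈-* (≈-* (≈-+ L≈1 (q-≈ (+ 1))) (≈-- (q-≈ (+ 4)) (≈-* (q-≈ (+ 10)) w≈0))) G≈1)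
            (≈-* (≈-- (≈-* (q-≈ (+ 9)) u≈0) (q-≈ (+ 4))) A≈1)

  x₃*A : x₃ * A ≡ R
  x₃*A = *-cancelʳ-≡ u u≢0 (begin
    x₃ * A * u                                              ≡⟨ regroup x₃ u ⟩
    (x₃ * u) * A                                            ≡⟨ cong (_* A) x₃*u ⟩
    (L * L * G - q (+ 4) * u - q (+ 1)) * A                 ≡⟨ expand L u G ⟩
    G * (L + q (+ 1)) * ((L - q (+ 1)) * A) + (G - q (+ 1) - q (+ 4) * u) * A
      ≡⟨ cong (λ a → G * (L + q (+ 1)) * a + (G - q (+ 1) - q (+ 4) * u) * A) [L-1]*A ⟩
    G * (L + q (+ 1)) * (u * (q (+ 4) - q (+ 10) * w)) + (G - q (+ 1) - q (+ 4) * u) * A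
      ≡⟨ factor L u w ⟩
    R * u                                                   ∎)
    where
    regroup : ∀ a u → a * (q (+ 1) - q (+ 4) * u) * u ≡ (a * u) * (q (+ 1) - q (+ 4) * u)
    regroup = ℚSolver.solve-∀ ℚ-ring
    expand : ∀ L u g → (L * L * g - q (+ 4) * u - q (+ 1)) * (q (+ 1) - q (+ 4) * u) ≡
      g * (L + q (+ 1)) * ((L - q (+ 1)) * (q (+ 1) - q (+ 4) * u)) + (g - q (+ 1) - q (+ 4) * u) * (q (+ 1) - q (+ 4) * u)
    expand = ℚSolver.solve-∀ ℚ-ring
    factor : ∀ L u w → (q (+ 1) + q (+ 9) * u * u) * (L + q (+ 1)) * (u * (q (+ 4) - q (+ 10) * w))
      + ((q (+ 1) + q (+ 9) * u * u) - q (+ 1) - q (+ 4) * u) * (q (+ 1) - q (+ 4) * u)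
      ≡ ((L + q (+ 1)) * (q (+ 4) - q (+ 10) * w) * (q (+ 1) + q (+ 9) * u * u) + (q (+ 9) * u - q (+ 4)) * (q (+ 1) - q (+ 4) * u)) * u
    factor = ℚSolver.solve-∀ ℚ-ring

  x₃≈1 : x₃ ≈ + 1 [mod + 3 ]
  x₃≈1 = ≈-÷ (divides (+ 1) refl) A≈1 (from-no (+ 3 ∣? + 1)) R≈4 (divides -[1+ 0 ] refl) x₃*A

  S : ℚ
  S = A * (q (+ 20) * G - q (+ 41) * w * G - q (+ 36) * u * w * G)
      - (q (+ 4) - q (+ 10) * w) * (q (+ 4) - q (+ 10) * w) * G * w * G

  S≈20 : S ≈ + 20 [mod + 3 ]
  S≈20 = ≈-- (≈-* A≈1 (≈-- (≈-- (≈-* (q-≈ (+ 20)) G≈1) (≈-* (≈-* (q-≈ (+ 41)) w≈0) G≈1))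
                          (≈-* (≈-* (≈-* (q-≈ (+ 36)) u≈0) w≈0) G≈1)))
             (≈-* (≈-* (≈-* (≈-* 4-10w≈4 4-10w≈4) G≈1) w≈0) G≈1)
    where
    4-10w≈4 : q (+ 4) - q (+ 10) * w ≈ + 4 ℤ.- + 10 ℤ.* + 0 [mod + 3 ]
    4-10w≈4 = ≈-- (q-≈ (+ 4)) (≈-* (q-≈ (+ 10)) w≈0)

  -- 4 - x₃ is divisible by w, which keeps the slope (of negative valuation) out of y₃
  [4-x₃]*A² : (q (+ 4) - x₃) * (A * A) ≡ w * S
  [4-x₃]*A² = begin
    (q (+ 4) - x₃) * (A * A)                      ≡⟨ expand x₃ u ⟩
    A * (q (+ 4) * A - x₃ * A)                    ≡⟨ cong (λ a → A * (q (+ 4) * A - a)) x₃*A ⟩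
    A * (q (+ 4) * A - R)                         ≡⟨ unfold-R L u w ⟩
    A * (q (+ 4) - q (+ 16) * u - (q (+ 9) * u - q (+ 4)) * A - q (+ 2) * (q (+ 4) - q (+ 10) * w) * G)
      - (q (+ 4) - q (+ 10) * w) * G * ((L - q (+ 1)) * A)
      ≡⟨ cong (λ a → A * (q (+ 4) - q (+ 16) * u - (q (+ 9) * u - q (+ 4)) * A - q (+ 2) * (q (+ 4) - q (+ 10) * w) * G)
                      - (q (+ 4) - q (+ 10) * w) * G * a) [L-1]*A ⟩
    A * (q (+ 4) - q (+ 16) * u - (q (+ 9) * u - q (+ 4)) * A - q (+ 2) * (q (+ 4) - q (+ 10) * w) * G)
      - (q (+ 4) - q (+ 10) * w) * G * (u * (q (+ 4) - q (+ 10) * w))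
      ≡⟨ collect u w ⟩
    A * (q (+ 20) * w * G - q (+ 41) * u - q (+ 36) * u * u) - (q (+ 4) - q (+ 10) * w) * (q (+ 4) - q (+ 10) * w) * G * u
      ≡⟨ cong (λ a → A * (q (+ 20) * w * G - q (+ 41) * a - q (+ 36) * u * a) - (q (+ 4) - q (+ 10) * w) * (q (+ 4) - q (+ 10) * w) * G * a) u≡w²G ⟩
    A * (q (+ 20) * w * G - q (+ 41) * (w * w * G) - q (+ 36) * u * (w * w * G))
      - (q (+ 4) - q (+ 10) * w) * (q (+ 4) - q (+ 10) * w) * G * (w * w * G)
      ≡⟨ factor u w ⟩
    w * S                                         ∎
    where
    expand : ∀ a u → (q (+ 4) - a) * ((q (+ 1) - q (+ 4) * u) * (q (+ 1) - q (+ 4) * u))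
      ≡ (q (+ 1) - q (+ 4) * u) * (q (+ 4) * (q (+ 1) - q (+ 4) * u) - a * (q (+ 1) - q (+ 4) * u))
    expand = ℚSolver.solve-∀ ℚ-ring
    unfold-R : ∀ L u w → (q (+ 1) - q (+ 4) * u) * (q (+ 4) * (q (+ 1) - q (+ 4) * u)
        - ((L + q (+ 1)) * (q (+ 4) - q (+ 10) * w) * (q (+ 1) + q (+ 9) * u * u) + (q (+ 9) * u - q (+ 4)) * (q (+ 1) - q (+ 4) * u)))
      ≡ (q (+ 1) - q (+ 4) * u) * (q (+ 4) - q (+ 16) * u - (q (+ 9) * u - q (+ 4)) * (q (+ 1) - q (+ 4) * u)
          - q (+ 2) * (q (+ 4) - q (+ 10) * w) * (q (+ 1) + q (+ 9) * u * u))
        - (q (+ 4) - q (+ 10) * w) * (q (+ 1) + q (+ 9) * u * u) * ((L - q (+ 1)) * (q (+ 1) - q (+ 4) * u))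
    unfold-R = ℚSolver.solve-∀ ℚ-ring
    collect : ∀ u w → (q (+ 1) - q (+ 4) * u) * (q (+ 4) - q (+ 16) * u - (q (+ 9) * u - q (+ 4)) * (q (+ 1) - q (+ 4) * u)
          - q (+ 2) * (q (+ 4) - q (+ 10) * w) * (q (+ 1) + q (+ 9) * u * u))
        - (q (+ 4) - q (+ 10) * w) * (q (+ 1) + q (+ 9) * u * u) * (u * (q (+ 4) - q (+ 10) * w))
      ≡ (q (+ 1) - q (+ 4) * u) * (q (+ 20) * w * (q (+ 1) + q (+ 9) * u * u) - q (+ 41) * u - q (+ 36) * u * u)
        - (q (+ 4) - q (+ 10) * w) * (q (+ 4) - q (+ 10) * w) * (q (+ 1) + q (+ 9) * u * u) * u
    collect = ℚSolver.solve-∀ ℚ-ring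
    factor : ∀ u w → (q (+ 1) - q (+ 4) * u) * (q (+ 20) * w * (q (+ 1) + q (+ 9) * u * u)
          - q (+ 41) * (w * w * (q (+ 1) + q (+ 9) * u * u)) - q (+ 36) * u * (w * w * (q (+ 1) + q (+ 9) * u * u)))
        - (q (+ 4) - q (+ 10) * w) * (q (+ 4) - q (+ 10) * w) * (q (+ 1) + q (+ 9) * u * u) * (w * w * (q (+ 1) + q (+ 9) * u * u))
      ≡ w * ((q (+ 1) - q (+ 4) * u) * (q (+ 20) * (q (+ 1) + q (+ 9) * u * u) - q (+ 41) * w * (q (+ 1) + q (+ 9) * u * u)
               - q (+ 36) * u * w * (q (+ 1) + q (+ 9) * u * u))
            - (q (+ 4) - q (+ 10) * w) * (q (+ 4) - q (+ 10) * w) * (q (+ 1) + q (+ 9) * u * u) * w * (q (+ 1) + q (+ 9) * u * u))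
    factor = ℚSolver.solve-∀ ℚ-ring

  y₃*A² : y₃ * (A * A) ≡ L * S - q (+ 10) * (A * A)
  y₃*A² = begin
    y₃ * (A * A)                                   ≡⟨ expand slope x₃ (A * A) ⟩
    slope * ((q (+ 4) - x₃) * (A * A)) - q (+ 10) * (A * A) ≡⟨ cong (λ a → slope * a - q (+ 10) * (A * A)) [4-x₃]*A² ⟩
    slope * (w * S) - q (+ 10) * (A * A)           ≡⟨ regroup slope w S (A * A) ⟩
    L * S - q (+ 10) * (A * A)                     ∎
    where
    expand : ∀ l a b → (l * (q (+ 4) - a) - q (+ 10)) * b ≡ l * ((q (+ 4) - a) * b) - q (+ 10) * b
    expand = ℚSolver.solve-∀ ℚ-ring
    regroup : ∀ l w s b → l * (w * s) - q (+ 10) * b ≡ (l * w) * s - q (+ 10) * b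
    regroup = ℚSolver.solve-∀ ℚ-ring

  y₃≈1 : y₃ ≈ + 1 [mod + 3 ]
  y₃≈1 = ≈-÷ (divides (+ 1) refl) (≈-* A≈1 A≈1) (from-no (+ 3 ∣? + 1))
           (≈-- (≈-* L≈1 S≈20) (≈-* (q-≈ (+ 10)) (≈-* A≈1 A≈1))) (divides -[1+ 2 ] refl) y₃*A²

  reduces : ReducesTo[1, + 1 ] (aff x₃ y₃)
  reduces = reduction (on-curve on) x₃≈1 y₃≈1

T⊕∞ : ∀ {P} → ReducesTo∞ P → ReducesTo[1, + 1 ] (T ⊕ P)
T⊕∞ at-O = T-reduction
T⊕∞ (reduction {x} on u*x≡1 w*y≡x u≈0 w≈0) with q (+ 4) ℚP.≟ x
... | no 4≢x = Chord[∞].reduces 4≢x on u*x≡1 w*y≡x u≈0 w≈0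
... | yes refl = ⊥-elim (≈-incompatible u≈1 u≈0 (from-no (+ 3 ∣? + 1)))
  where
  u≈1 : _ ≈ + 1 [mod + 3 ]
  u≈1 = fraction (+ 1) (+ 4) (from-no (+ 3 ∣? + 4)) u*x≡1 (divides -[1+ 0 ] refl)

ImageNear[5,unit] ImageNear[2,0] : Point → Set
ImageNear[5,unit] P = (v 3 (proj₁ (h P) - q (+ 5)) ≥ᵥ + 2) × (v 3 (proj₂ (h P)) ≡ just (+ 0))
ImageNear[2,0] P = (v 3 (proj₂ (h P)) ≥ᵥ + 1) × (v 3 (proj₁ (h P) - q (+ 2)) ≥ᵥ + 1)

image-of-[1,s] : ∀ {s P} → 3∤ s → ReducesTo[1, s ] P → ImageNear[5,unit] P
image-of-[1,s] {s} 3∤s (reduction {x} {y} _ x≈1 y≈s) = v₃≥2 t-5≈0 , v₃-unit s≈s 3∤s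
  where
  open ≡-Reasoning
  3+x≈4 : q (+ 3) + x ≈ + 4 [mod + 3 ]
  3+x≈4 = ≈-+ (q-≈ (+ 3)) x≈1
  t : ℚ
  t = (q (+ 3) - x) // (q (+ 3) + x)
  t*[3+x] : t * (q (+ 3) + x) ≡ q (+ 3) - x
  t*[3+x] = //-*-cancel (q (+ 3) - x) (≈-3∤⇒≢0 3+x≈4 (from-no (+ 3 ∣? + 4)))
  [t-5]*[3+x] : (t - q (+ 5)) * (q (+ 3) + x) ≡ q (ℤ.- + 2) * (q (+ 3) * (x + q (+ 2)))
  [t-5]*[3+x] = begin
    (t - q (+ 5)) * (q (+ 3) + x)                ≡⟨ expand t x ⟩
    t * (q (+ 3) + x) - q (+ 5) * (q (+ 3) + x)  ≡⟨ cong (_- q (+ 5) * (q (+ 3) + x)) t*[3+x] ⟩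
    (q (+ 3) - x) - q (+ 5) * (q (+ 3) + x)      ≡⟨ factor x ⟩
    q (ℤ.- + 2) * (q (+ 3) * (x + q (+ 2)))      ∎
    where
    expand : ∀ t x → (t - q (+ 5)) * (q (+ 3) + x) ≡ t * (q (+ 3) + x) - q (+ 5) * (q (+ 3) + x)
    expand = ℚSolver.solve-∀ ℚ-ring
    factor : ∀ x → (q (+ 3) - x) - q (+ 5) * (q (+ 3) + x) ≡ q (ℤ.- + 2) * (q (+ 3) * (x + q (+ 2)))
    factor = ℚSolver.solve-∀ ℚ-ring
  t-5≈0 : t - q (+ 5) ≈ + 0 [mod + 9 ]
  t-5≈0 = ≈0-÷ 3+x≈4 (from-no (+ 3 ∣? + 4))
            (≈-* (q-≈ (ℤ.- + 2)) (≈0-3* (≈-shift (divides (+ 1) refl) (≈-+ x≈1 (q-≈ (+ 2))))))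
            [t-5]*[3+x]
  x+3≈4 : x + q (+ 3) ≈ + 4 [mod + 3 ]
  x+3≈4 = ≈-+ x≈1 (q-≈ (+ 3))
  [x+3]²≢0 : (x + q (+ 3)) * (x + q (+ 3)) ≢ 0ℚ
  [x+3]²≢0 = ≈-3∤⇒≢0 (≈-* x+3≈4 x+3≈4) (from-no (+ 3 ∣? + 16))
  s≈s : (q (ℤ.- + 2) * y) // ((x + q (+ 3)) * (x + q (+ 3))) ≈ s [mod + 3 ]
  s≈s = ≈-÷ (divides (+ 1) refl) (≈-* x+3≈4 x+3≈4) (from-no (+ 3 ∣? + 16)) (≈-* (q-≈ (ℤ.- + 2)) y≈s)
          (divides (s ℤ.* + 6) (ℤSolver.solve (s ∷ []))) (//-*-cancel (q (ℤ.- + 2) * y) [x+3]²≢0)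

image-of-∞ : ∀ {P} → ReducesTo∞ P → ImageNear[2,0] P
image-of-∞ at-O = tt , ℤ.+≤+ (s≤s z≤n)
image-of-∞ (reduction {x} {y} {u} {w} on u*x≡1 w*y≡x u≈0 w≈0) = v₃≥1 s≈0 , v₃≥1 t-2≈0
  where
  open ≡-Reasoning
  [3+x]*u : (q (+ 3) + x) * u ≡ q (+ 3) * u + q (+ 1)
  [3+x]*u = trans (expand x u) (cong (λ a → q (+ 3) * u + a) u*x≡1)
    where
    expand : ∀ x u → (q (+ 3) + x) * u ≡ q (+ 3) * u + u * x
    expand = ℚSolver.solve-∀ ℚ-ring
  [3+x]*u≈1 : (q (+ 3) + x) * u ≈ + 1 [mod + 3 ]
  [3+x]*u≈1 = subst (_≈ + 1 [mod + 3 ]) (sym [3+x]*u) (≈-+ (≈-* (q-≈ (+ 3)) u≈0) (q-≈ (+ 1)))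
  3+x≢0 : q (+ 3) + x ≢ 0ℚ
  3+x≢0 3+x≡0 = ≈-3∤⇒≢0 [3+x]*u≈1 (from-no (+ 3 ∣? + 1)) (trans (cong (_* u) 3+x≡0) (ℚP.*-zeroˡ u))
  t : ℚ
  t = (q (+ 3) - x) // (q (+ 3) + x)
  [t-2]*[3+x]*u : (t - q (+ 2)) * ((q (+ 3) + x) * u) ≡ q (ℤ.- + 3) * (u + q (+ 1))
  [t-2]*[3+x]*u = begin
    (t - q (+ 2)) * ((q (+ 3) + x) * u)                    ≡⟨ expand t x u ⟩
    (t * (q (+ 3) + x)) * u - q (+ 2) * (q (+ 3) + x) * u  ≡⟨ cong (λ a → a * u - q (+ 2) * (q (+ 3) + x) * u)
                                                                  (//-*-cancel (q (+ 3) - x) 3+x≢0) ⟩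
    (q (+ 3) - x) * u - q (+ 2) * (q (+ 3) + x) * u        ≡⟨ collect x u ⟩
    q (ℤ.- + 3) * u - q (+ 3) * (u * x)                    ≡⟨ cong (λ a → q (ℤ.- + 3) * u - q (+ 3) * a) u*x≡1 ⟩
    q (ℤ.- + 3) * u - q (+ 3) * q (+ 1)                    ≡⟨ factor u ⟩
    q (ℤ.- + 3) * (u + q (+ 1))                            ∎
    where
    expand : ∀ t x u → (t - q (+ 2)) * ((q (+ 3) + x) * u) ≡ (t * (q (+ 3) + x)) * u - q (+ 2) * (q (+ 3) + x) * u
    expand = ℚSolver.solve-∀ ℚ-ring
    collect : ∀ x u → (q (+ 3) - x) * u - q (+ 2) * (q (+ 3) + x) * u ≡ q (ℤ.- + 3) * u - q (+ 3) * (u * x)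
    collect = ℚSolver.solve-∀ ℚ-ring
    factor : ∀ u → q (ℤ.- + 3) * u - q (+ 3) * q (+ 1) ≡ q (ℤ.- + 3) * (u + q (+ 1))
    factor = ℚSolver.solve-∀ ℚ-ring
  t-2≈0 : t - q (+ 2) ≈ + 0 [mod + 3 ]
  t-2≈0 = ≈0-÷ [3+x]*u≈1 (from-no (+ 3 ∣? + 1))
            (≈-* (≈-shift {s = + 0} (divides -[1+ 0 ] refl) (q-≈ (ℤ.- + 3))) (≈-+ u≈0 (q-≈ (+ 1)))) [t-2]*[3+x]*u
  G : ℚ
  G = q (+ 1) + q (+ 9) * u * u
  [x+3]²≢0 : (x + q (+ 3)) * (x + q (+ 3)) ≢ 0ℚ
  [x+3]²≢0 [x+3]²≡0 = 3+x≢0 (trans (ℚP.+-comm (q (+ 3)) x) x+3≡0)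
    where
    x+3≡0 : x + q (+ 3) ≡ 0ℚ
    x+3≡0 = *-cancelʳ-≡ (x + q (+ 3)) (λ e → 3+x≢0 (trans (ℚP.+-comm (q (+ 3)) x) e))
              (trans [x+3]²≡0 (sym (ℚP.*-zeroˡ (x + q (+ 3)))))
  s : ℚ
  s = (q (ℤ.- (+ 2)) * y) // ((x + q (+ 3)) * (x + q (+ 3)))
  -- (1 + 3u)² = u² (x + 3)², so this clears the denominator of s
  s*[1+3u]² : s * ((q (+ 1) + q (+ 3) * u) * (q (+ 1) + q (+ 3) * u)) ≡ q (ℤ.- (+ 2)) * (w * G)
  s*[1+3u]² = begin
    s * ((q (+ 1) + q (+ 3) * u) * (q (+ 1) + q (+ 3) * u))
      ≡⟨ cong (λ a → s * ((a + q (+ 3) * u) * (a + q (+ 3) * u))) (sym u*x≡1) ⟩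
    s * ((u * x + q (+ 3) * u) * (u * x + q (+ 3) * u))   ≡⟨ regroup₁ s u x ⟩
    (s * ((x + q (+ 3)) * (x + q (+ 3)))) * (u * u)       ≡⟨ cong (_* (u * u)) (//-*-cancel (q (ℤ.- (+ 2)) * y) [x+3]²≢0) ⟩
    (q (ℤ.- (+ 2)) * y) * (u * u)                         ≡⟨ cong (λ a → (q (ℤ.- (+ 2)) * y) * (u * a)) (u≡w²[1+9u²] {y = y} {w = w} on u*x≡1 w*y≡x) ⟩
    (q (ℤ.- (+ 2)) * y) * (u * (w * w * G))               ≡⟨ regroup₂ y u w G ⟩
    q (ℤ.- (+ 2)) * ((w * y) * (u * w * G))               ≡⟨ cong (λ a → q (ℤ.- (+ 2)) * (a * (u * w * G))) w*y≡x ⟩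
    q (ℤ.- (+ 2)) * (x * (u * w * G))                     ≡⟨ regroup₃ x u w G ⟩
    q (ℤ.- (+ 2)) * ((u * x) * (w * G))                   ≡⟨ cong (λ a → q (ℤ.- (+ 2)) * (a * (w * G))) u*x≡1 ⟩
    q (ℤ.- (+ 2)) * (q (+ 1) * (w * G))                   ≡⟨ cong (q (ℤ.- (+ 2)) *_) (ℚP.*-identityˡ (w * G)) ⟩
    q (ℤ.- (+ 2)) * (w * G)                               ∎
    where
    regroup₁ : ∀ s u x → s * ((u * x + q (+ 3) * u) * (u * x + q (+ 3) * u)) ≡ (s * ((x + q (+ 3)) * (x + q (+ 3)))) * (u * u)
    regroup₁ = ℚSolver.solve-∀ ℚ-ring
    regroup₂ : ∀ y u w g → (q (ℤ.- (+ 2)) * y) * (u * (w * w * g)) ≡ q (ℤ.- (+ 2)) * ((w * y) * (u * w * g))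
    regroup₂ = ℚSolver.solve-∀ ℚ-ring
    regroup₃ : ∀ x u w g → q (ℤ.- (+ 2)) * (x * (u * w * g)) ≡ q (ℤ.- (+ 2)) * ((u * x) * (w * g))
    regroup₃ = ℚSolver.solve-∀ ℚ-ring
  s≈0 : s ≈ + 0 [mod + 3 ]
  s≈0 = ≈0-÷ (≈-* 1+3u≈1 1+3u≈1) (from-no (+ 3 ∣? + 1))
          (≈-* (q-≈ (ℤ.- + 2)) (≈-* w≈0 (≈-+ (q-≈ (+ 1)) (≈-* (≈-* (q-≈ (+ 9)) u≈0) u≈0)))) s*[1+3u]²
    where
    1+3u≈1 : q (+ 1) + q (+ 3) * u ≈ + 1 [mod + 3 ]
    1+3u≈1 = ≈-+ (q-≈ (+ 1)) (≈-* (q-≈ (+ 3)) u≈0)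

reductions-of-multiples : ∀ j → ReducesTo∞ ([ j ℕ.* 3 ] T)
                              × ReducesTo[1, + 1 ] ([ 1 ℕ.+ j ℕ.* 3 ] T)
                              × ReducesTo[1, ℤ.- + 1 ] ([ 2 ℕ.+ j ℕ.* 3 ] T)
reductions-of-multiples zero = at-O , T-reduction , T⊕[1,1] T-reduction
reductions-of-multiples (suc j) with T⊕[1,-1] (proj₂ (proj₂ (reductions-of-multiples j)))
... | r₀ = r₀ , T⊕∞ r₀ , T⊕[1,1] (T⊕∞ r₀)

image-of-multiples : ∀ r j → r ℕ.< 3 → (r ≡ 0 → ImageNear[2,0] ([ r ℕ.+ j ℕ.* 3 ] T))
                                      × (r ≢ 0 → ImageNear[5,unit] ([ r ℕ.+ j ℕ.* 3 ] T))
image-of-multiples 0 j _ = (λ _ → image-of-∞ (proj₁ (reductions-of-multiples j))) , λ 0≢0 → ⊥-elim (0≢0 refl)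
image-of-multiples 1 j _ = (λ ()) , λ _ →
  image-of-[1,s] (from-no (+ 3 ∣? + 1)) (proj₁ (proj₂ (reductions-of-multiples j)))
image-of-multiples 2 j _ = (λ ()) , λ _ →
  image-of-[1,s] (from-no (+ 3 ∣? ℤ.- + 1)) (proj₂ (proj₂ (reductions-of-multiples j)))
image-of-multiples (suc (suc (suc _))) _ (s≤s (s≤s (s≤s ())))

lemma1 : (k : ℕ) → 1 ≤ k →
    (k % 3 ≡ 0 → (v 3 (sₖ k) ≥ᵥ + 1) × (v 3 (tₖ k - (+ 2 / 1)) ≥ᵥ + 1))
    × (k % 3 ≢ 0 → (v 3 (tₖ k - (+ 5 / 1)) ≥ᵥ + 2) × (v 3 (sₖ k) ≡ just (+ 0)))
lemma1 k _ with image-of-multiples (k % 3) (k ℕ./ 3) (ℕDivMod.m%n<n k 3)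
... | case₀ , case₁₂ = (λ k%3≡0 → at-k {ImageNear[2,0]} (case₀ k%3≡0))
                    , (λ k%3≢0 → at-k {ImageNear[5,unit]} (case₁₂ k%3≢0))
  where
  at-k : ∀ {C : Point → Set} → C ([ k % 3 ℕ.+ (k ℕ./ 3) ℕ.* 3 ] T) → C ([ k ] T)
  at-k {C} = subst (λ n → C ([ n ] T)) (sym (ℕDivMod.m≡m%n+[m/n]*n k 3))
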